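{- Let $m,n$ be positive integers, and let $\mathcal{M}_{m,n}$ and $\mathcal{K}_{m,n}$ be the Möbius-strip and Klein-bottle knight's graphs described in the context. (1) Suppose $n$ is odd. If $m$ is odd and at least one of $m$ and $n$ is larger than $1$, then there is no nullhomotopic knight's tour on $\mathcal{M}_{m,n}$ and no nullhomotopic knight's tour on $\mathcal{K}_{m,n}$. (2) Suppose $n$ is even. If $m$ is even, then there is no generating tour on $\mathcal{M}_{m,n}$ and no Möbius tour on $\mathcal{K}_{m,n}$. If $m$ is odd, then there is no cylindrical tour on $\mathcal{K}_{m,n}$.
   Context: Fix positive integers $m,n$. Knight moves are displacements $(c,d)\in\mathbb{Z}^2$ with $\{|c|,|d|\}=\{1,2\}$. The strip graph $\mathcal{S}_m$ has vertex set $\{(a,b)\in\mathbb{Z}^2: 0\le a<m\}$, with an edge between two vertices whenever they differ by a knight move. The plane graph $\mathcal{P}$ has vertex set $\mathbb{Z}^2$ and edges between vertices differing by a knight move. Let $\tau(a,b)=(m-1-a,\,b+n)$ and $t(a,b)=(a+m,\,b)$. These are graph automorphisms ($\tau$ of $\mathcal{S}_m$ and of $\mathcal{P}$, $t$ of $\mathcal{P}$). The Möbius-strip knight's graph $\mathcal{M}_{m,n}$ is the quotient of $\mathcal{S}_m$ by the group $\langle\tau\rangle$. The Klein-bottle knight's graph $\mathcal{K}_{m,n}$ is the quotient of $\mathcal{P}$ by the group $\langle t,\tau\rangle$. In each quotient, vertices are orbits of vertices and edges are orbits of edges, so each quotient may be a multigraph or pseudograph, possibly with loops and multiple edges. Each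 quotient has $mn$ vertices, represented by $(a,b)$ with $0\le a<m$ and $0\le b<n$, and the quotient maps are graph covering maps. These graphs model knight moves on an $m\times n$ board whose top and bottom edges are glued with a twist (Möbius strip $M$), and additionally whose left and right edges are glued without a twist (Klein bottle $K$). The vertex $(a,b)$ corresponds to the center $(a+.5,b+.5)$ of a unit square. A knight's tour is a Hamiltonian cycle: a closed walk along edges that visits every vertex exactly once. We take it to be based at the vertex $(0,0)$. On a one-vertex graph, the trivial closed walk counts as a tour. A tour has a unique lift to a walk in the covering graph ($\mathcal{S}_m$ or $\mathcal{P}$) starting at $(0,0)$. Via the natural maps of the graphs into the surfaces, a tour determines an element of $\pi_1(M)$ or $\pi_1(K)$, and this element is determined by the endpoint of the lift: - A tour on $\mathcal{M}_{m,n}$ is nullhomotopic (represents the identity of $\pi_1(M)$) iff its lift to $\mathcal{S}_m$ ends at $(0,0)$. - A tour on $\mathcal{M}_{m,n}$ is generating (represents a generator of $\pi_1(M)\cong\mathbb{Z}$) iff its lift ends at $(m-1,\pm n)$. - A tour on $\mathcal{K}_{m,n}$ is nullhomotopic iff its lift to $\mathcal{P}$ ends at $(0,0)$. - A tour on $\mathcal{K}_{m,n}$ is cylindrical (represents the image of a generator of the fundamental group of the cylinder under the quotient map to $K$) iff its lift ends at $(\pm m,0)$. - A tour on $\mathcal{K}_{m,n}$ is Möbius (represents the image of a generator of the fundamental group of the Möbius strip under the quotient map to $K$) iff its lift ends at $(m-1,\pm n)$. -}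

module Defs where

open import Data.Nat as ℕ using (ℕ; suc)
open import Data.Integer as ℤ using (ℤ; +_; -_; _-_; ∣_∣)
open import Data.Product using (_×_; _,_; ∃)
open import Data.Sum using (_⊎_)
open import Data.Unit using (⊤)
open import Data.List using (List; []; _∷_)
open import Data.List.Relation.Unary.All using (All)
open import Data.List.Relation.Unary.Any using (Any)
open import Data.List.Relation.Unary.AllPairs using (AllPairs)
open import Relation.Binary.PropositionalEquality using (_≡_)
open import Relation.Nullary using (¬_)

Even : ℕ → Set
Even n = ∃ λ k → n ≡ 2 ℕ.* k

Odd : ℕ → Set
Odd n = ∃ λ k → n ≡ suc (2 ℕ.* k)

-- Points of ℤ², vertices of the covering graphs
Pt : Set
Pt = ℤ × ℤ

origin : Pt
origin = (+ 0 , + 0)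

_⊕_ : Pt → Pt → Pt
(a , b) ⊕ (c , d) = (a ℤ.+ c , b ℤ.+ d)

IsKnight : Pt → Set
IsKnight (c , d) = (∣ c ∣ ≡ 1 × ∣ d ∣ ≡ 2) ⊎ (∣ c ∣ ≡ 2 × ∣ d ∣ ≡ 1)

τ : ℕ → ℕ → Pt → Pt
τ m n (a , b) = ((+ m - + 1) - a , b ℤ.+ + n)

τ⁻¹ : ℕ → ℕ → Pt → Pt
τ⁻¹ m n (a , b) = ((+ m - + 1) - a , b - + n)

t : ℕ → Pt → Pt
t m (a , b) = (a ℤ.+ + m , b)

t⁻¹ : ℕ → Pt → Pt
t⁻¹ m (a , b) = (a - + m , b)

data OrbM (m n : ℕ) (p : Pt) : Pt → Set where
  here  : OrbM m n p p
  stepτ  : ∀ {q} → OrbM m n p q → OrbM m n p (τ m n q)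
  stepτ⁻¹ : ∀ {q} → OrbM m n p q → OrbM m n p (τ⁻¹ m n q)

data OrbK (m n : ℕ) (p : Pt) : Pt → Set where
  here  : OrbK m n p p
  stepτ  : ∀ {q} → OrbK m n p q → OrbK m n p (τ m n q)
  stepτ⁻¹ : ∀ {q} → OrbK m n p q → OrbK m n p (τ⁻¹ m n q)
  stept  : ∀ {q} → OrbK m n p q → OrbK m n p (t m q)
  stept⁻¹ : ∀ {q} → OrbK m n p q → OrbK m n p (t⁻¹ m q)

InStrip : ℕ → Pt → Set
InStrip m (a , b) = + 0 ℤ.≤ a × a ℤ.< + m

positions : Pt → List Pt → List Pt
positions p [] = p ∷ []
positions p (d ∷ ds) = p ∷ positions (p ⊕ d) ds

endpoint : Pt → List Pt → Pt
endpoint p [] = p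
endpoint p (d ∷ ds) = endpoint (p ⊕ d) ds

-- vertices visited by a closed walk (the final return to the start is not
-- counted again); the trivial closed walk visits its base point.
visitedOpen : Pt → List Pt → List Pt
visitedOpen p [] = []
visitedOpen p (d ∷ ds) = p ∷ visitedOpen (p ⊕ d) ds

visited : Pt → List Pt → List Pt
visited p [] = p ∷ []
visited p (d ∷ ds) = visitedOpen p (d ∷ ds)

-- A knight's tour on the quotient of the graph with vertex predicate V
-- (covering graph) by the group with orbit relation _~_, based at (0,0),
-- given by its (unique) lift starting at (0,0), i.e. by the list ds of
-- knight displacements of the lifted walk.
record IsTour (V : Pt → Set) (_~_ : Pt → Pt → Set) (m n : ℕ) (ds : List Pt) : Set where
  field
    knight   : All IsKnight ds
    inGraph  : All V (positions origin ds)
    closed   : origin ~ endpoint origin ds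
    distinct : AllPairs (λ p q → ¬ (p ~ q)) (visited origin ds)
    covers   : ∀ a b → a ℕ.< m → b ℕ.< n → Any (λ q → (+ a , + b) ~ q) (visited origin ds)

MTour : ℕ → ℕ → List Pt → Set
MTour m n = IsTour (InStrip m) (OrbM m n) m n

KTour : ℕ → ℕ → List Pt → Set
KTour m n = IsTour (λ _ → ⊤) (OrbK m n) m n

-- Homotopy classes, via the endpoint of the lift
lift-end : List Pt → Pt
lift-end ds = endpoint origin ds

Nullhomotopic : List Pt → Set
Nullhomotopic ds = lift-end ds ≡ origin

Generating : ℕ → ℕ → List Pt → Set
Generating m n ds = (lift-end ds ≡ (+ m - + 1 , + n)) ⊎ (lift-end ds ≡ (+ m - + 1 , - (+ n)))

MöbiusClass : ℕ → ℕ → List Pt → Set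
MöbiusClass = Generating

Cylindrical : ℕ → List Pt → Set
Cylindrical m ds = (lift-end ds ≡ (+ m , + 0)) ⊎ (lift-end ds ≡ (- (+ m) , + 0))

-- Colour the square (x, y) by the parity of x + y.  A knight move always changes colour, so
-- the lift of a closed knight walk with L moves ends on a square of colour L mod 2.  A tour
-- visits every vertex of the quotient once, i.e. one point of every orbit of ⟨τ⟩ (resp.
-- ⟨t, τ⟩), and these orbits are in bijection with the squares of the m × n box, so L = mn.
-- The endpoints (0, 0), (m - 1, ±n) and (±m, 0) of the lifts in the three homotopy classes
-- have colours 0, m + 1 + n and m, which contradicts L = mn under the stated parities.

module Submission where

open import Defs
open import Data.Nat using (ℕ; _<_; _≤_)
open import Data.Product using (_×_)
open import Data.Sum using (_⊎_)
open import Data.List using (List)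
open import Relation.Nullary using (¬_)

open import Data.Empty using (⊥-elim)
open import Data.Integer as ℤ using (ℤ; +_; +[1+_]; -[1+_]; -_; _-_; _⊖_; ∣_∣; 0ℤ; +≤+; +<+)
open import Data.Integer.DivMod using (_%ℕ_; _/ℕ_; a≡a%ℕn+[a/ℕn]*n; n%ℕd<d)
import Data.Integer.Properties as ℤ
open import Data.Integer.Tactic.RingSolver using (solve-∀)
open import Data.List using ([]; _∷_; length; upTo; cartesianProduct; map)
open import Data.List.Membership.Propositional using (_∈_)
open import Data.List.Membership.Propositional.Properties
  using (∈-upTo⁺; ∈-upTo⁻; ∈-cartesianProduct⁺; ∈-cartesianProduct⁻)
open import Data.List.Membership.Propositional.Properties.WithK using (unique∧set⇒bag)
open import Data.List.Properties using (length-++; length-map; length-upTo)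
open import Data.List.Relation.Binary.BagAndSetEquality using (∼bag⇒↭)
open import Data.List.Relation.Binary.Permutation.Propositional.Properties using (↭-length)
open import Data.List.Relation.Unary.All as All using (All; []; _∷_)
open import Data.List.Relation.Unary.AllPairs using (AllPairs; []; _∷_)
open import Data.List.Relation.Unary.Any using (Any; here; there)
open import Data.List.Relation.Unary.Unique.Propositional using (Unique)
import Data.List.Relation.Unary.Unique.Propositional.Properties as Unique
open import Data.Nat as ℕ using (zero; suc; parity)
import Data.Nat.Properties as ℕ
open import Data.Parity as ℙ using (Parity; 0ℙ; 1ℙ)
import Data.Parity.Properties as ℙ
open import Algebra.Properties.CommutativeSemigroup ℙ.+-commutativeSemigroup using (interchange)
open import Data.Product using (∃; ∃₂; _,_; proj₁)
open import Data.Product.Properties using (,-injectiveˡ; ,-injectiveʳ)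
open import Data.Sum using (inj₁; inj₂)
open import Function.Bundles using (mk⇔)
open import Relation.Binary.Definitions using (Symmetric; Transitive)
open import Relation.Binary.PropositionalEquality
open ≡-Reasoning

-- Parity of integers and colour of squares

parityℤ : ℤ → Parity
parityℤ z = parity ∣ z ∣

parity[1+m]+parity[1+n] : ∀ m n → parity (suc m) ℙ.+ parity (suc n) ≡ parity (m ℕ.+ n)
parity[1+m]+parity[1+n] m n = begin
  parity (suc m) ℙ.+ parity (suc n) ≡⟨ ℙ.+-homo-+ (suc m) (suc n) ⟨
  parity (suc (m ℕ.+ suc n))        ≡⟨ cong (λ k → parity (suc k)) (ℕ.+-suc m n) ⟩
  parity (m ℕ.+ n)                  ∎

parity∣m⊖n∣ : ∀ m n → parity ∣ m ⊖ n ∣ ≡ parity m ℙ.+ parity n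
parity∣m⊖n∣ zero    n       = cong parity (ℤ.∣⊖∣-≤ (ℕ.z≤n {n}))
parity∣m⊖n∣ (suc m) zero    = sym (ℙ.+-identityʳ (parity (suc m)))
parity∣m⊖n∣ (suc m) (suc n) = begin
  parity ∣ suc m ⊖ suc n ∣          ≡⟨ cong (λ z → parity ∣ z ∣) (ℤ.[1+m]⊖[1+n]≡m⊖n m n) ⟩
  parity ∣ m ⊖ n ∣                  ≡⟨ parity∣m⊖n∣ m n ⟩
  parity m ℙ.+ parity n             ≡⟨ ℙ.+-homo-+ m n ⟨
  parity (m ℕ.+ n)                  ≡⟨ parity[1+m]+parity[1+n] m n ⟨
  parity (suc m) ℙ.+ parity (suc n) ∎

parityℤ-homo-+ : ∀ x y → parityℤ (x ℤ.+ y) ≡ parityℤ x ℙ.+ parityℤ y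
parityℤ-homo-+ (+ m)    (+ n)    = ℙ.+-homo-+ m n
parityℤ-homo-+ (+ m)    -[1+ n ] = parity∣m⊖n∣ m (suc n)
parityℤ-homo-+ -[1+ m ] (+ n)    = trans (parity∣m⊖n∣ n (suc m)) (ℙ.+-comm (parity n) (parity (suc m)))
parityℤ-homo-+ -[1+ m ] -[1+ n ] = sym (parity[1+m]+parity[1+n] m n)

parityℤ-homo-neg : ∀ x → parityℤ (- x) ≡ parityℤ x
parityℤ-homo-neg x = cong parity (ℤ.∣-i∣≡∣i∣ x)

parityℤ-homo-- : ∀ x y → parityℤ (x - y) ≡ parityℤ x ℙ.+ parityℤ y
parityℤ-homo-- x y = trans (parityℤ-homo-+ x (- y)) (cong (parityℤ x ℙ.+_) (parityℤ-homo-neg y))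

colour : Pt → Parity
colour (x , y) = parityℤ x ℙ.+ parityℤ y

colour-homo-⊕ : ∀ p q → colour (p ⊕ q) ≡ colour p ℙ.+ colour q
colour-homo-⊕ (a , b) (c , d) = begin
  parityℤ (a ℤ.+ c) ℙ.+ parityℤ (b ℤ.+ d)
    ≡⟨ cong₂ ℙ._+_ (parityℤ-homo-+ a c) (parityℤ-homo-+ b d) ⟩
  (parityℤ a ℙ.+ parityℤ c) ℙ.+ (parityℤ b ℙ.+ parityℤ d)
    ≡⟨ interchange (parityℤ a) (parityℤ c) (parityℤ b) (parityℤ d) ⟩
  (parityℤ a ℙ.+ parityℤ b) ℙ.+ (parityℤ c ℙ.+ parityℤ d)
    ∎

knight-colour : ∀ {d} → IsKnight d → colour d ≡ 1ℙ
knight-colour (inj₁ (∣c∣≡1 , ∣d∣≡2)) = cong₂ (λ i j → parity i ℙ.+ parity j) ∣c∣≡1 ∣d∣≡2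
knight-colour (inj₂ (∣c∣≡2 , ∣d∣≡1)) = cong₂ (λ i j → parity i ℙ.+ parity j) ∣c∣≡2 ∣d∣≡1

colour-endpoint : ∀ p ds → All IsKnight ds → colour (endpoint p ds) ≡ colour p ℙ.+ parity (length ds)
colour-endpoint p []       []         = sym (ℙ.+-identityʳ (colour p))
colour-endpoint p (d ∷ ds) (kd ∷ kds) = begin
  colour (endpoint (p ⊕ d) ds)        ≡⟨ colour-endpoint (p ⊕ d) ds kds ⟩
  colour (p ⊕ d) ℙ.+ L                ≡⟨ cong (ℙ._+ L) (colour-homo-⊕ p d) ⟩
  colour p ℙ.+ colour d ℙ.+ L         ≡⟨ cong (λ c → colour p ℙ.+ c ℙ.+ L) (knight-colour {d} kd) ⟩
  colour p ℙ.+ 1ℙ ℙ.+ L               ≡⟨ ℙ.+-assoc (colour p) 1ℙ L ⟩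
  colour p ℙ.+ (1ℙ ℙ.+ L)             ≡⟨ cong (colour p ℙ.+_) (ℙ.+-homo-+ 1 (length ds)) ⟨
  colour p ℙ.+ parity (1 ℕ.+ length ds) ∎
  where
  L : Parity
  L = parity (length ds)

even⇒parity≡0ℙ : ∀ {n} → Even n → parity n ≡ 0ℙ
even⇒parity≡0ℙ (k , refl) = ℙ.*-homo-* 2 k

odd⇒parity≡1ℙ : ∀ {n} → Odd n → parity n ≡ 1ℙ
odd⇒parity≡1ℙ (k , refl) = trans (ℙ.+-homo-+ 1 (2 ℕ.* k)) (cong (1ℙ ℙ.+_) (ℙ.*-homo-* 2 k))

even-product-parity : ∀ {m n} → Even m ⊎ Even n → parity (m ℕ.* n) ≡ 0ℙ
even-product-parity {m} {n} (inj₁ em) =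
  trans (ℙ.*-homo-* m n) (cong (ℙ._* parity n) (even⇒parity≡0ℙ em))
even-product-parity {m} {n} (inj₂ en) =
  trans (ℙ.*-homo-* m n) (trans (cong (parity m ℙ.*_) (even⇒parity≡0ℙ en)) (ℙ.*-zeroʳ (parity m)))

parity≡0ℙ⇒≢1 : ∀ {N} → parity N ≡ 0ℙ → N ≢ 1
parity≡0ℙ⇒≢1 () refl

length-visitedOpen : ∀ p ds → length (visitedOpen p ds) ≡ length ds
length-visitedOpen p []       = refl
length-visitedOpen p (d ∷ ds) = cong suc (length-visitedOpen (p ⊕ d) ds)

-- The trivial closed walk makes no move but visits one square.
closed-walk-colour : ∀ {ds N} → All IsKnight ds → length (visited origin ds) ≡ N → N ≢ 1 →
                     colour (lift-end ds) ≡ parity N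
closed-walk-colour {[]}     _   size N≢1 = ⊥-elim (N≢1 (sym size))
closed-walk-colour {d ∷ ds} kds size _   = trans (colour-endpoint origin (d ∷ ds) kds)
  (cong parity (trans (sym (length-visitedOpen origin (d ∷ ds))) size))

nullhomotopic-colour : ∀ {ds} → Nullhomotopic ds → colour (lift-end ds) ≡ 0ℙ
nullhomotopic-colour null = cong colour null

generating-colour : ∀ {m n ds} → Generating m n ds → colour (lift-end ds) ≡ parity m ℙ.+ 1ℙ ℙ.+ parity n
generating-colour {m} {n} (inj₁ end) =
  trans (cong colour end) (cong (ℙ._+ parity n) (parityℤ-homo-- (+ m) (+ 1)))
generating-colour {m} {n} (inj₂ end) =
  trans (cong colour end) (cong₂ ℙ._+_ (parityℤ-homo-- (+ m) (+ 1)) (parityℤ-homo-neg (+ n)))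

cylindrical-colour : ∀ {m ds} → Cylindrical m ds → colour (lift-end ds) ≡ parity m
cylindrical-colour {m} (inj₁ end) = trans (cong colour end) (ℙ.+-identityʳ (parity m))
cylindrical-colour {m} (inj₂ end) =
  trans (cong colour end) (trans (ℙ.+-identityʳ (parityℤ (- + m))) (parityℤ-homo-neg (+ m)))

no-nullhomotopic : ∀ {m n ds} → Odd m → Odd n → (1 < m ⊎ 1 < n) →
                   All IsKnight ds → length (visited origin ds) ≡ m ℕ.* n → ¬ Nullhomotopic ds
no-nullhomotopic {m} {n} {ds} om on big kds size null = ℙ.p≢p⁻¹ 0ℙ (begin
  0ℙ                    ≡⟨ nullhomotopic-colour {ds} null ⟨
  colour (lift-end ds)  ≡⟨ closed-walk-colour kds size (mn≢1 big) ⟩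
  parity (m ℕ.* n)      ≡⟨ ℙ.*-homo-* m n ⟩
  parity m ℙ.* parity n ≡⟨ cong₂ ℙ._*_ (odd⇒parity≡1ℙ om) (odd⇒parity≡1ℙ on) ⟩
  1ℙ                    ∎)
  where
  mn≢1 : 1 < m ⊎ 1 < n → m ℕ.* n ≢ 1
  mn≢1 (inj₁ 1<m) mn≡1 = ℕ.<-irrefl (sym (ℕ.m*n≡1⇒m≡1 m n mn≡1)) 1<m
  mn≢1 (inj₂ 1<n) mn≡1 = ℕ.<-irrefl (sym (ℕ.m*n≡1⇒n≡1 m n mn≡1)) 1<n

no-generating : ∀ {m n ds} → Even m → Even n →
                All IsKnight ds → length (visited origin ds) ≡ m ℕ.* n → ¬ Generating m n ds
no-generating {m} {n} {ds} em en kds size gen = ℙ.p≢p⁻¹ 0ℙ (begin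
  0ℙ                           ≡⟨ even-mn ⟨
  parity (m ℕ.* n)             ≡⟨ closed-walk-colour kds size (parity≡0ℙ⇒≢1 even-mn) ⟨
  colour (lift-end ds)         ≡⟨ generating-colour {m} {n} {ds} gen ⟩
  parity m ℙ.+ 1ℙ ℙ.+ parity n ≡⟨ cong₂ (λ p q → p ℙ.+ 1ℙ ℙ.+ q) (even⇒parity≡0ℙ em) (even⇒parity≡0ℙ en) ⟩
  1ℙ                           ∎)
  where
  even-mn : parity (m ℕ.* n) ≡ 0ℙ
  even-mn = even-product-parity (inj₁ em)

no-cylindrical : ∀ {m n ds} → Odd m → Even n →
                 All IsKnight ds → length (visited origin ds) ≡ m ℕ.* n → ¬ Cylindrical m ds
no-cylindrical {m} {n} {ds} om en kds size cyl = ℙ.p≢p⁻¹ 0ℙ (begin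
  0ℙ                   ≡⟨ even-mn ⟨
  parity (m ℕ.* n)     ≡⟨ closed-walk-colour kds size (parity≡0ℙ⇒≢1 even-mn) ⟨
  colour (lift-end ds) ≡⟨ cylindrical-colour {m} {ds} cyl ⟩
  parity m             ≡⟨ odd⇒parity≡1ℙ om ⟩
  1ℙ                   ∎)
  where
  even-mn : parity (m ℕ.* n) ≡ 0ℙ
  even-mn = even-product-parity {m} (inj₂ en)

-- Counting transversals

module _ {A C : Set} {_~_ : A → A → Set} (~-sym : Symmetric _~_) (~-trans : Transitive _~_)
         (ι : C → A) {box : List C} (box-unique : Unique box)
         (ι-injective : ∀ {c c′} → c ∈ box → c′ ∈ box → ι c ~ ι c′ → c ≡ c′) where

  HasRepresentative : A → Set
  HasRepresentative x = ∃ λ c → c ∈ box × ι c ~ x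

  private
    representatives : ∀ {xs} → All HasRepresentative xs → List C
    representatives = All.reduce proj₁

    length-representatives : ∀ {xs} (rs : All HasRepresentative xs) →
                             length (representatives rs) ≡ length xs
    length-representatives []       = refl
    length-representatives (r ∷ rs) = cong suc (length-representatives rs)

    representatives⊆box : ∀ {xs} (rs : All HasRepresentative xs) {c} → c ∈ representatives rs → c ∈ box
    representatives⊆box ((_ , c∈box , _) ∷ rs) (here refl) = c∈box
    representatives⊆box (_ ∷ rs)                (there c∈) = representatives⊆box rs c∈

    representatives-unique : ∀ {xs} (rs : All HasRepresentative xs) → AllPairs (λ x y → ¬ x ~ y) xs →
                             Unique (representatives rs)
    representatives-unique []       []         = []
    representatives-unique (r ∷ rs) (x≁ ∷ x≁s) = distinct r rs x≁ ∷ representatives-unique rs x≁s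
      where
      distinct : ∀ {x ys} (r : HasRepresentative x) (rs : All HasRepresentative ys) →
                 All (λ y → ¬ x ~ y) ys → All (proj₁ r ≢_) (representatives rs)
      distinct r               []                    []         = []
      distinct r@(_ , _ , c~x) ((_ , _ , c′~y) ∷ rs) (x≁y ∷ x≁ys) =
        (λ { refl → x≁y (~-trans (~-sym c~x) c′~y) }) ∷ distinct r rs x≁ys

    box⊆representatives : ∀ {xs} (rs : All HasRepresentative xs) {c} → c ∈ box →
                          Any (ι c ~_) xs → c ∈ representatives rs
    box⊆representatives ((c′ , c′∈box , c′~x) ∷ rs) c∈box (here c~x) =
      here (ι-injective c∈box c′∈box (~-trans c~x (~-sym c′~x)))
    box⊆representatives (_ ∷ rs) c∈box (there c~xs) = there (box⊆representatives rs c∈box c~xs)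

  length-transversal : ∀ {xs} → All HasRepresentative xs → AllPairs (λ x y → ¬ x ~ y) xs →
                       (∀ {c} → c ∈ box → Any (ι c ~_) xs) → length xs ≡ length box
  length-transversal {xs} rs xs≁ covers = begin
    length xs                   ≡⟨ length-representatives rs ⟨
    length (representatives rs) ≡⟨ ↭-length (∼bag⇒↭ (unique∧set⇒bag
                                     (representatives-unique rs xs≁) box-unique
                                     (mk⇔ (representatives⊆box rs)
                                          (λ c∈box → box⊆representatives rs c∈box (covers c∈box))))) ⟩
    length box                  ∎

box : ℕ → ℕ → List (ℕ × ℕ)
box m n = cartesianProduct (upTo m) (upTo n)

square : ℕ × ℕ → Pt
square (a , b) = (+ a , + b)

∈-box⁺ : ∀ {m n a b} → a < m → b < n → (a , b) ∈ box m n
∈-box⁺ a<m b<n = ∈-cartesianProduct⁺ (∈-upTo⁺ a<m) (∈-upTo⁺ b<n)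

∈-box⁻ : ∀ {m n a b} → (a , b) ∈ box m n → a < m × b < n
∈-box⁻ {m} {n} ab∈ with a∈ , b∈ ← ∈-cartesianProduct⁻ (upTo m) (upTo n) ab∈ = ∈-upTo⁻ a∈ , ∈-upTo⁻ b∈

box-unique : ∀ m n → Unique (box m n)
box-unique m n = Unique.cartesianProduct⁺ (Unique.upTo⁺ m) (Unique.upTo⁺ n)

length-cartesianProduct : ∀ {A B : Set} (xs : List A) (ys : List B) →
                          length (cartesianProduct xs ys) ≡ length xs ℕ.* length ys
length-cartesianProduct []       ys = refl
length-cartesianProduct (x ∷ xs) ys = trans (length-++ (map (x ,_) ys))
  (cong₂ ℕ._+_ (length-map (x ,_) ys) (length-cartesianProduct xs ys))

length-box : ∀ m n → length (box m n) ≡ m ℕ.* n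
length-box m n =
  trans (length-cartesianProduct (upTo m) (upTo n)) (cong₂ ℕ._*_ (length-upTo m) (length-upTo n))

-- Orbits of ⟨τ⟩ and ⟨t, τ⟩

k-[k-x]≡x : ∀ k x → k - (k - x) ≡ x
k-[k-x]≡x = solve-∀

x+y-y≡x : ∀ x y → x ℤ.+ y - y ≡ x
x+y-y≡x = solve-∀

x-y+y≡x : ∀ x y → x - y ℤ.+ y ≡ x
x-y+y≡x = solve-∀

x+0*k≡x : ∀ x k → x ℤ.+ 0ℤ ℤ.* k ≡ x
x+0*k≡x = solve-∀

x+j*k+k≡x+[1+j]*k : ∀ x j k → x ℤ.+ j ℤ.* k ℤ.+ k ≡ x ℤ.+ (+ 1 ℤ.+ j) ℤ.* k
x+j*k+k≡x+[1+j]*k = solve-∀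

x+j*k-k≡x+[-1+j]*k : ∀ x j k → x ℤ.+ j ℤ.* k - k ≡ x ℤ.+ (- + 1 ℤ.+ j) ℤ.* k
x+j*k-k≡x+[-1+j]*k = solve-∀

l-[x+j*k]≡l-x+[-j]*k : ∀ l x j k → l - (x ℤ.+ j ℤ.* k) ≡ l - x ℤ.+ (- j) ℤ.* k
l-[x+j*k]≡l-x+[-j]*k = solve-∀

k-1-x≡k-[1+x] : ∀ k x → k - + 1 - x ≡ k - (+ 1 ℤ.+ x)
k-1-x≡k-[1+x] = solve-∀

move-multiple : ∀ {x y} c K → x ≡ y ℤ.+ c ℤ.* K → y ≡ x ℤ.+ (- c) ℤ.* K
move-multiple {y = y} c K refl = y≡y+c*K+[-c]*K y c K
  where
  y≡y+c*K+[-c]*K : ∀ y c K → y ≡ y ℤ.+ c ℤ.* K ℤ.+ (- c) ℤ.* K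
  y≡y+c*K+[-c]*K = solve-∀

residue-multiple≡0 : ∀ {K u v} c → u < K → v < K → + v ≡ + u ℤ.+ c ℤ.* + K → c ≡ 0ℤ
residue-multiple≡0 (+ zero) _ _ _ = refl
residue-multiple≡0 {K} {u} {v} +[1+ k ] _ v<K v≡ = ⊥-elim (ℕ.<⇒≱ v<K
  (ℕ.≤-trans (ℕ.m≤m+n K (k ℕ.* K)) (ℕ.≤-trans (ℕ.m≤n+m (suc k ℕ.* K) u) (ℕ.≤-reflexive v≡′))))
  where
  v≡′ : u ℕ.+ suc k ℕ.* K ≡ v
  v≡′ = ℤ.+-injective (trans (cong (λ z → + u ℤ.+ z) (ℤ.pos-* (suc k) K)) (sym v≡))
residue-multiple≡0 {K} -[1+ k ] u<K v<K v≡
  with () ← residue-multiple≡0 +[1+ k ] v<K u<K (move-multiple -[1+ k ] (+ K) v≡)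

ℤ-induction : ∀ (P : ℤ → Set) → P 0ℤ → (∀ i → P i → P (+ 1 ℤ.+ i)) → (∀ i → P i → P (- + 1 ℤ.+ i)) →
              ∀ i → P i
ℤ-induction P P0 P-suc P-pred (+ k)    = up k
  where
  up : ∀ k → P (+ k)
  up zero    = P0
  up (suc k) = P-suc (+ k) (up k)
ℤ-induction P P0 P-suc P-pred -[1+ k ] = down k
  where
  down : ∀ k → P -[1+ k ]
  down zero    = P-pred 0ℤ P0
  down (suc k) = P-pred -[1+ k ] (down k)

module _ (m n : ℕ) where

  τ⁻¹-τ : ∀ q → τ⁻¹ m n (τ m n q) ≡ q
  τ⁻¹-τ (a , b) = cong₂ _,_ (k-[k-x]≡x (+ m - + 1) a) (x+y-y≡x b (+ n))

  τ-τ⁻¹ : ∀ q → τ m n (τ⁻¹ m n q) ≡ q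
  τ-τ⁻¹ (a , b) = cong₂ _,_ (k-[k-x]≡x (+ m - + 1) a) (x-y+y≡x b (+ n))

  t⁻¹-t : ∀ q → t⁻¹ m (t m q) ≡ q
  t⁻¹-t (a , b) = cong (_, b) (x+y-y≡x a (+ m))

  t-t⁻¹ : ∀ q → t m (t⁻¹ m q) ≡ q
  t-t⁻¹ (a , b) = cong (_, b) (x-y+y≡x a (+ m))

  OrbM-trans : Transitive (OrbM m n)
  OrbM-trans o here          = o
  OrbM-trans o (stepτ o′)    = stepτ (OrbM-trans o o′)
  OrbM-trans o (stepτ⁻¹ o′)  = stepτ⁻¹ (OrbM-trans o o′)

  OrbK-trans : Transitive (OrbK m n)
  OrbK-trans o here          = o
  OrbK-trans o (stepτ o′)    = stepτ (OrbK-trans o o′)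
  OrbK-trans o (stepτ⁻¹ o′)  = stepτ⁻¹ (OrbK-trans o o′)
  OrbK-trans o (stept o′)    = stept (OrbK-trans o o′)
  OrbK-trans o (stept⁻¹ o′)  = stept⁻¹ (OrbK-trans o o′)

  OrbM-sym : Symmetric (OrbM m n)
  OrbM-sym here            = here
  OrbM-sym (stepτ {q} o)   = OrbM-trans (subst (OrbM m n (τ m n q)) (τ⁻¹-τ q) (stepτ⁻¹ here)) (OrbM-sym o)
  OrbM-sym (stepτ⁻¹ {q} o) = OrbM-trans (subst (OrbM m n (τ⁻¹ m n q)) (τ-τ⁻¹ q) (stepτ here)) (OrbM-sym o)

  OrbK-sym : Symmetric (OrbK m n)
  OrbK-sym here            = here
  OrbK-sym (stepτ {q} o)   = OrbK-trans (subst (OrbK m n (τ m n q)) (τ⁻¹-τ q) (stepτ⁻¹ here)) (OrbK-sym o)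
  OrbK-sym (stepτ⁻¹ {q} o) = OrbK-trans (subst (OrbK m n (τ⁻¹ m n q)) (τ-τ⁻¹ q) (stepτ here)) (OrbK-sym o)
  OrbK-sym (stept {q} o)   = OrbK-trans (subst (OrbK m n (t m q)) (t⁻¹-t q) (stept⁻¹ here)) (OrbK-sym o)
  OrbK-sym (stept⁻¹ {q} o) = OrbK-trans (subst (OrbK m n (t⁻¹ m q)) (t-t⁻¹ q) (stept here)) (OrbK-sym o)

  OrbM⇒OrbK : ∀ {p q} → OrbM m n p q → OrbK m n p q
  OrbM⇒OrbK here         = here
  OrbM⇒OrbK (stepτ o)    = stepτ (OrbM⇒OrbK o)
  OrbM⇒OrbK (stepτ⁻¹ o)  = stepτ⁻¹ (OrbM⇒OrbK o)

  reflectIf : Parity → ℤ → ℤ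
  reflectIf 0ℙ x = x
  reflectIf 1ℙ x = (+ m - + 1) - x

  -- Every element of ⟨t, τ⟩ is tʲ τᶜ, and τᶜ reflects the first coordinate iff c is odd.
  KleinOrbit : Pt → Pt → Set
  KleinOrbit (a , b) q = ∃₂ λ j c → q ≡ (reflectIf (parityℤ c) a ℤ.+ j ℤ.* + m , b ℤ.+ c ℤ.* + n)

  reflect-shift : ∀ a j c c′ → parityℤ c′ ≡ 1ℙ ℙ.+ parityℤ c →
    (+ m - + 1) - (reflectIf (parityℤ c) a ℤ.+ j ℤ.* + m) ≡ reflectIf (parityℤ c′) a ℤ.+ (- j) ℤ.* + m
  reflect-shift a j c c′ c′-parity = begin
    (+ m - + 1) - (reflectIf (parityℤ c) a ℤ.+ j ℤ.* + m)
      ≡⟨ l-[x+j*k]≡l-x+[-j]*k (+ m - + 1) (reflectIf (parityℤ c) a) j (+ m) ⟩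
    (+ m - + 1) - reflectIf (parityℤ c) a ℤ.+ (- j) ℤ.* + m
      ≡⟨ cong (λ x → x ℤ.+ (- j) ℤ.* + m) (reflect-reflectIf (parityℤ c)) ⟩
    reflectIf (1ℙ ℙ.+ parityℤ c) a ℤ.+ (- j) ℤ.* + m
      ≡⟨ cong (λ p → reflectIf p a ℤ.+ (- j) ℤ.* + m) c′-parity ⟨
    reflectIf (parityℤ c′) a ℤ.+ (- j) ℤ.* + m
      ∎
    where
    reflect-reflectIf : ∀ p → (+ m - + 1) - reflectIf p a ≡ reflectIf (1ℙ ℙ.+ p) a
    reflect-reflectIf 0ℙ = refl
    reflect-reflectIf 1ℙ = k-[k-x]≡x (+ m - + 1) a

  OrbK⇒KleinOrbit : ∀ {p q} → OrbK m n p q → KleinOrbit p q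
  OrbK⇒KleinOrbit {a , b} here = 0ℤ , 0ℤ , sym (cong₂ _,_ (x+0*k≡x a (+ m)) (x+0*k≡x b (+ n)))
  OrbK⇒KleinOrbit {a , b} (stepτ o) with j , c , refl ← OrbK⇒KleinOrbit o =
    - j , + 1 ℤ.+ c ,
    cong₂ _,_ (reflect-shift a j c (+ 1 ℤ.+ c) (parityℤ-homo-+ (+ 1) c)) (x+j*k+k≡x+[1+j]*k b c (+ n))
  OrbK⇒KleinOrbit {a , b} (stepτ⁻¹ o) with j , c , refl ← OrbK⇒KleinOrbit o =
    - j , - + 1 ℤ.+ c ,
    cong₂ _,_ (reflect-shift a j c (- + 1 ℤ.+ c) (parityℤ-homo-+ (- + 1) c)) (x+j*k-k≡x+[-1+j]*k b c (+ n))
  OrbK⇒KleinOrbit {a , b} (stept o) with j , c , refl ← OrbK⇒KleinOrbit o =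
    + 1 ℤ.+ j , c , cong (_, b ℤ.+ c ℤ.* + n) (x+j*k+k≡x+[1+j]*k (reflectIf (parityℤ c) a) j (+ m))
  OrbK⇒KleinOrbit {a , b} (stept⁻¹ o) with j , c , refl ← OrbK⇒KleinOrbit o =
    - + 1 ℤ.+ j , c , cong (_, b ℤ.+ c ℤ.* + n) (x+j*k-k≡x+[-1+j]*k (reflectIf (parityℤ c) a) j (+ m))

  OrbK-box-injective : ∀ {c c′} → c ∈ box m n → c′ ∈ box m n → OrbK m n (square c) (square c′) → c ≡ c′
  OrbK-box-injective {a , b} {a′ , b′} c∈ c′∈ o
    with a<m , b<n ← ∈-box⁻ c∈ | a′<m , b′<n ← ∈-box⁻ c′∈ | j , k , eq ← OrbK⇒KleinOrbit o
    with refl ← residue-multiple≡0 k b<n b′<n (,-injectiveʳ eq)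
    with refl ← residue-multiple≡0 j a<m a′<m (,-injectiveˡ eq)
    = sym (cong₂ _,_ (ℤ.+-injective (trans (,-injectiveˡ eq) (x+0*k≡x (+ a) (+ m))))
                     (ℤ.+-injective (trans (,-injectiveʳ eq) (x+0*k≡x (+ b) (+ n)))))

  private
    StripWalk : ℤ → Set
    StripWalk Q = ∀ {a} → a < m → ∀ r → ∃ λ a′ → a′ < m × OrbM m n (+ a′ , r) (+ a , r ℤ.+ Q ℤ.* + n)

    reflect-below : ∀ {a} → a < m → (+ m - + 1) - + a ≡ + (m ℕ.∸ suc a)
    reflect-below {a} a<m = trans (k-1-x≡k-[1+x] (+ m) (+ a)) (ℤ.⊖-≥ a<m)

    reflect-above : ∀ {a} → a < m → (+ m - + 1) - + (m ℕ.∸ suc a) ≡ + a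
    reflect-above {a} a<m =
      trans (cong (λ x → (+ m - + 1) - x) (sym (reflect-below a<m))) (k-[k-x]≡x (+ m - + 1) (+ a))

    ∸-suc-< : ∀ {a} → a < m → m ℕ.∸ suc a < m
    ∸-suc-< {a} (ℕ.s≤s _) = ℕ.s≤s (ℕ.m∸n≤m _ a)

    walk-τ : ∀ Q → StripWalk Q → StripWalk (+ 1 ℤ.+ Q)
    walk-τ Q walk {a} a<m r with a′ , a′<m , o ← walk (∸-suc-< a<m) r =
      a′ , a′<m , subst (OrbM m n (+ a′ , r))
                        (cong₂ _,_ (reflect-above a<m) (x+j*k+k≡x+[1+j]*k r Q (+ n))) (stepτ o)

    walk-τ⁻¹ : ∀ Q → StripWalk Q → StripWalk (- + 1 ℤ.+ Q)
    walk-τ⁻¹ Q walk {a} a<m r with a′ , a′<m , o ← walk (∸-suc-< a<m) r =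
      a′ , a′<m , subst (OrbM m n (+ a′ , r))
                        (cong₂ _,_ (reflect-above a<m) (x+j*k-k≡x+[-1+j]*k r Q (+ n))) (stepτ⁻¹ o)

    strip-walk : ∀ Q → StripWalk Q
    strip-walk = ℤ-induction StripWalk
      (λ {a} a<m r → a , a<m , subst (λ y → OrbM m n (+ a , r) (+ a , y)) (sym (x+0*k≡x r (+ n))) here)
      walk-τ walk-τ⁻¹

    walk-t : ∀ Q x y → OrbK m n (x , y) (x ℤ.+ Q ℤ.* + m , y)
    walk-t = ℤ-induction (λ Q → ∀ x y → OrbK m n (x , y) (x ℤ.+ Q ℤ.* + m , y))
      (λ x y → subst (λ z → OrbK m n (x , y) (z , y)) (sym (x+0*k≡x x (+ m))) here)
      (λ Q walk x y → subst (λ z → OrbK m n (x , y) (z , y)) (x+j*k+k≡x+[1+j]*k x Q (+ m))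
                            (stept (walk x y)))
      (λ Q walk x y → subst (λ z → OrbK m n (x , y) (z , y)) (x+j*k-k≡x+[-1+j]*k x Q (+ m))
                            (stept⁻¹ (walk x y)))

  strip-representative : .{{_ : ℕ.NonZero n}} → ∀ q → InStrip m q →
                         ∃ λ c → c ∈ box m n × OrbM m n (square c) q
  strip-representative (+ a , y) (+≤+ _ , +<+ a<m)
    with a′ , a′<m , o ← strip-walk (y /ℕ n) a<m (+ (y %ℕ n)) =
    (a′ , y %ℕ n) , ∈-box⁺ a′<m (n%ℕd<d y n) ,
    subst (λ z → OrbM m n (+ a′ , + (y %ℕ n)) (+ a , z)) (sym (a≡a%ℕn+[a/ℕn]*n y n)) o

  klein-representative : .{{_ : ℕ.NonZero m}} .{{_ : ℕ.NonZero n}} → ∀ q →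
                         ∃ λ c → c ∈ box m n × OrbK m n (square c) q
  klein-representative (x , y)
    with c , c∈ , o ← strip-representative (+ (x %ℕ m) , y) (+≤+ ℕ.z≤n , +<+ (n%ℕd<d x m)) =
    c , c∈ , OrbK-trans (OrbM⇒OrbK o)
      (subst (λ z → OrbK m n (+ (x %ℕ m) , y) (z , y)) (sym (a≡a%ℕn+[a/ℕn]*n x m))
             (walk-t (x /ℕ m) (+ (x %ℕ m)) y))

-- Tours visit mn squares

All-visitedOpen : ∀ {P : Pt → Set} p ds → All P (positions p ds) → All P (visitedOpen p ds)
All-visitedOpen p []       _          = []
All-visitedOpen p (d ∷ ds) (Pp ∷ Ps) = Pp ∷ All-visitedOpen (p ⊕ d) ds Ps

All-visited : ∀ {P : Pt → Set} p ds → All P (positions p ds) → All P (visited p ds)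
All-visited p []       Ps = Ps
All-visited p (d ∷ ds) Ps = All-visitedOpen p (d ∷ ds) Ps

box-covered : ∀ {m n} {P : Pt → Set} → (∀ a b → a < m → b < n → P (+ a , + b)) →
              ∀ {c} → c ∈ box m n → P (square c)
box-covered P-box {a , b} c∈ with a<m , b<n ← ∈-box⁻ c∈ = P-box a b a<m b<n

tour-size : ∀ {V : Pt → Set} {_~_ : Pt → Pt → Set} {m n ds} → Symmetric _~_ → Transitive _~_ →
            (∀ {c c′} → c ∈ box m n → c′ ∈ box m n → square c ~ square c′ → c ≡ c′) →
            (∀ q → V q → ∃ λ c → c ∈ box m n × square c ~ q) →
            IsTour V _~_ m n ds → length (visited origin ds) ≡ m ℕ.* n
tour-size {_~_ = _~_} {m} {n} {ds} ~-sym ~-trans box-injective representative T = trans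
  (length-transversal ~-sym ~-trans square (box-unique m n) box-injective
    (All.map (λ {q} → representative q) (All-visited origin ds (inGraph T)))
    (distinct T)
    (box-covered {P = λ p → Any (p ~_) (visited origin ds)} (covers T)))
  (length-box m n)
  where open IsTour

MTour-size : ∀ {m n ds} .{{_ : ℕ.NonZero n}} → MTour m n ds → length (visited origin ds) ≡ m ℕ.* n
MTour-size {m} {n} = tour-size (OrbM-sym m n) (OrbM-trans m n)
  (λ c∈ c′∈ o → OrbK-box-injective m n c∈ c′∈ (OrbM⇒OrbK m n o)) (strip-representative m n)

KTour-size : ∀ {m n ds} .{{_ : ℕ.NonZero m}} .{{_ : ℕ.NonZero n}} → KTour m n ds →
             length (visited origin ds) ≡ m ℕ.* n
KTour-size {m} {n} = tour-size (OrbK-sym m n) (OrbK-trans m n) (OrbK-box-injective m n)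
  (λ q _ → klein-representative m n q)

proposition3p5 : (m n : ℕ) → 1 ≤ m → 1 ≤ n →
    (Odd n → Odd m → (1 < m ⊎ 1 < n) →
        (∀ ds → MTour m n ds → ¬ Nullhomotopic ds)
      × (∀ ds → KTour m n ds → ¬ Nullhomotopic ds))
    × (Even n →
        (Even m →
            (∀ ds → MTour m n ds → ¬ Generating m n ds)
          × (∀ ds → KTour m n ds → ¬ MöbiusClass m n ds))
      × (Odd m → ∀ ds → KTour m n ds → ¬ Cylindrical m ds))
proposition3p5 _ _ (ℕ.s≤s _) (ℕ.s≤s _) =
  (λ on om big →
      (λ ds T → no-nullhomotopic om on big (knight T) (MTour-size T))
    , (λ ds T → no-nullhomotopic om on big (knight T) (KTour-size T)))
  , λ en →
      (λ em →
          (λ ds T → no-generating em en (knight T) (MTour-size T))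
        , (λ ds T → no-generating em en (knight T) (KTour-size T)))
    , (λ om ds T → no-cylindrical om en (knight T) (KTour-size T))
  where open IsTour
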